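{- Let $(R,B)$ be a feasible solution that is locally optimum for the $p$-swap heuristic (for some integer $p\ge1$), let $(R^*,B^*)$ be an optimum feasible solution, and put $S=R\cup B$, $O=R^*\cup B^*$, assuming $S\cap O=\emptyset$. Then $S\cup O$ can be partitioned into sets $T$ (called blocks) such that each block $T$ satisfies: (i) $|T\cap R|=|T\cap R^*|$ and $|T\cap B|=|T\cap B^*|$; (ii) for every $i\in S\cap T$ we have $\phi^{ -1}(i)\subseteq T$, and for every $i^*\in O\cap T$ we have $\phi(i^*)\in T$; (iii) there is a facility $\hat i\in T\cap S$ with $\deg(\hat i)>0$ (the leader of $T$) such that every $i\in (T\cap S)\setminus\{\hat i\}$ is good or very good, and all good facilities in $(T\cap S)\setminus\{\hat i\}$ have the same colour.
   Context: Budgeted Red-Blue Median: clients $C$, red facilities $\mathcal R$, blue facilities $\mathcal B$ in a metric space with metric $d$, integers $k_r,k_b$; a feasible solution is $(R,B)$ with $R\subseteq\mathcal R$, $B\subseteq\mathcal B$, $|R|=k_r$, $|B|=k_b$, with cost $\sum_{j\in C}\min_{i\in R\cup B}d(i,j)$. Locally optimum for the $p$-swap heuristic: no feasible $(R',B')$ with $|R\setminus R'|\le p$, $|B\setminus B'|\le p$ has strictly smaller cost. The colour of a facility is red if it lies in $\mathcal R$ and blue if it lies in $\mathcal B$. $\phi:O\to S$ maps each facility of $O$ to a nearest facility of $S$ (ties broken arbitrarily). For $i\in S$, $\deg(i)=|\phi^{ -1}(i)|$. A facility $i\in S$ is very good if $\deg(i)=0$, good if $\deg(i)>0$ and no $i^*\in\phi^{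 -1}(i)$ has the same colour as $i$, and bad otherwise.
   Formalization: The metric $d$ takes rational values. -}

module Defs where

open import Data.Nat using (ℕ; _≤_; _<_)
open import Data.Bool using (Bool; true; false; _∧_)
open import Data.Fin using (Fin; _≟_)
open import Data.Fin.Subset using (Subset; _∈_; _∉_; _⊆_; _∪_; _∩_; _─_; ∣_∣)
open import Data.Vec using (lookup; tabulate)
open import Data.List using (List; []; _∷_; map; foldr; filterᵇ; allFin)
open import Data.Maybe using (Maybe; just; nothing; maybe; fromMaybe)
open import Data.Product using (_×_; Σ; ∃; _,_)
open import Data.Sum using (_⊎_)
open import Data.Rational using (ℚ; 0ℚ; _+_; _⊓_) renaming (_≤_ to _≤ℚ_)
open import Relation.Nullary using (¬_; ⌊_⌋)
open import Relation.Binary.PropositionalEquality using (_≡_; _≢_)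

record IsMetric {n : ℕ} (d : Fin n → Fin n → ℚ) : Set where
  field
    nonneg  : ∀ x y → 0ℚ ≤ℚ d x y
    zero⇔eq : ∀ x y → (d x y ≡ 0ℚ → x ≡ y) × (x ≡ y → d x y ≡ 0ℚ)
    sym     : ∀ x y → d x y ≡ d y x
    triangle : ∀ x y z → d x z ≤ℚ (d x y + d y z)

members : {n : ℕ} → Subset n → List (Fin n)
members {n} X = filterᵇ (lookup X) (allFin n)

minL : List ℚ → Maybe ℚ
minL [] = nothing
minL (x ∷ xs) = just (maybe (x ⊓_) x (minL xs))

sumℚ : List ℚ → ℚ
sumℚ = foldr _+_ 0ℚ

-- distance from client j to the nearest facility of X
-- (convention: 0 if X is empty; irrelevant)
servDist : {n : ℕ} → (Fin n → Fin n → ℚ) → Subset n → Fin n → ℚ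
servDist d X j = fromMaybe 0ℚ (minL (map (λ i → d i j) (members X)))

cost : {n : ℕ} → (Fin n → Fin n → ℚ) → (C R B : Subset n) → ℚ
cost d C R B = sumℚ (map (servDist d (R ∪ B)) (members C))

Feasible : {n : ℕ} → (𝓡 𝓑 : Subset n) → (kr kb : ℕ) → (R B : Subset n) → Set
Feasible 𝓡 𝓑 kr kb R B = R ⊆ 𝓡 × B ⊆ 𝓑 × ∣ R ∣ ≡ kr × ∣ B ∣ ≡ kb

LocallyOptimal : {n : ℕ} → (d : Fin n → Fin n → ℚ) → (C 𝓡 𝓑 : Subset n) →
                 (kr kb p : ℕ) → (R B : Subset n) → Set
LocallyOptimal d C 𝓡 𝓑 kr kb p R B =
  Feasible 𝓡 𝓑 kr kb R B ×
  (∀ R' B' → Feasible 𝓡 𝓑 kr kb R' B' → ∣ R ─ R' ∣ ≤ p → ∣ B ─ B' ∣ ≤ p →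
     cost d C R B ≤ℚ cost d C R' B')

Optimal : {n : ℕ} → (d : Fin n → Fin n → ℚ) → (C 𝓡 𝓑 : Subset n) →
          (kr kb : ℕ) → (R B : Subset n) → Set
Optimal d C 𝓡 𝓑 kr kb R B =
  Feasible 𝓡 𝓑 kr kb R B ×
  (∀ R' B' → Feasible 𝓡 𝓑 kr kb R' B' → cost d C R B ≤ℚ cost d C R' B')

IsNearestMap : {n : ℕ} → (Fin n → Fin n → ℚ) → (S O : Subset n) → (Fin n → Fin n) → Set
IsNearestMap d S O φ = ∀ o → o ∈ O → φ o ∈ S × (∀ s → s ∈ S → d o (φ o) ≤ℚ d o s)

preimage : {n : ℕ} → (Fin n → Fin n) → Subset n → Fin n → Subset n
preimage φ O i = tabulate (λ x → lookup O x ∧ ⌊ φ x ≟ i ⌋)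

deg : {n : ℕ} → (Fin n → Fin n) → Subset n → Fin n → ℕ
deg φ O i = ∣ preimage φ O i ∣

SameColour : {n : ℕ} → (𝓡 𝓑 : Subset n) → Fin n → Fin n → Set
SameColour 𝓡 𝓑 i j = (i ∈ 𝓡 × j ∈ 𝓡) ⊎ (i ∈ 𝓑 × j ∈ 𝓑)

VeryGood : {n : ℕ} → (Fin n → Fin n) → Subset n → Fin n → Set
VeryGood φ O i = deg φ O i ≡ 0

Good : {n : ℕ} → (𝓡 𝓑 : Subset n) → (Fin n → Fin n) → Subset n → Fin n → Set
Good 𝓡 𝓑 φ O i = 0 < deg φ O i × (∀ o → o ∈ preimage φ O i → ¬ SameColour 𝓡 𝓑 i o)

IsPartition : {n m : ℕ} → Subset n → (Fin m → Subset n) → Set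
IsPartition X ℬ =
  (∀ a → ℬ a ⊆ X) ×
  (∀ x → x ∈ X → ∃ λ a → x ∈ ℬ a) ×
  (∀ a b x → x ∈ ℬ a → x ∈ ℬ b → a ≡ b) ×
  (∀ a → ∃ λ x → x ∈ ℬ a)

BlockConditions : {n : ℕ} → (𝓡 𝓑 R B R* B* : Subset n) → (φ : Fin n → Fin n) → Subset n → Set
BlockConditions {n} 𝓡 𝓑 R B R* B* φ T =
  let S = R ∪ B ; O = R* ∪ B* in
  (∣ T ∩ R ∣ ≡ ∣ T ∩ R* ∣ × ∣ T ∩ B ∣ ≡ ∣ T ∩ B* ∣) ×
  ((∀ i → i ∈ S ∩ T → preimage φ O i ⊆ T) × (∀ o → o ∈ O ∩ T → φ o ∈ T)) ×
  (Σ (Fin n) λ lead → lead ∈ T ∩ S × 0 < deg φ O lead ×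
     (∀ i → i ∈ T ∩ S → i ≢ lead → Good 𝓡 𝓑 φ O i ⊎ VeryGood φ O i) ×
     (∀ i j → i ∈ T ∩ S → j ∈ T ∩ S → i ≢ lead → j ≢ lead →
        Good 𝓡 𝓑 φ O i → Good 𝓡 𝓑 φ O j → SameColour 𝓡 𝓑 i j))

{-# OPTIONS --safe #-}
module Submission where

-- Let r(i) and b(i) be the numbers of red and blue facilities of O that φ sends to i ∈ S.
-- Since |R| = |R*| and |B| = |B*|, S has exactly Σ r red and Σ b blue facilities.  The
-- facilities of S are placed into groups one at a time, keeping every group slack: it has at
-- most Σ r red and at most Σ b blue members, the sums running over the group.  A bad facility
-- starts a group of its own.  With c₀ a colour having at least as many good facilities as the
-- other, each good facility of the other colour starts a group together with a good facility
-- of colour c₀; each of the two has a preimage of the other's colour.  The facilities left are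
-- very good or good of colour c₀, and after those of colour c₀ only very good ones remain, so
-- no pending facility has a preimage of the colour being placed.  The global balance of that
-- colour then leaves a group strictly slack in it, which the facility joins.  Once all are
-- placed, the global equalities force equality in every group, and a block is a group
-- together with the φ-preimages of its members.

open import Defs
open import Data.Nat using (ℕ; _≤_)
open import Data.Fin using (Fin)
open import Data.Fin.Subset using (Subset; _∈_; _∉_; _∪_)
open import Data.Rational using (ℚ)
open import Data.Product using (Σ; _×_)

import Data.Nat.Properties as ℕ
open import Algebra.Properties.CommutativeMonoid.Sum ℕ.+-0-commutativeMonoid
  using (sum-syntax; ∑-distrib-+; ∑-comm; sum-cong-≗; sum-replicate-zero)
open import Data.Bool using (Bool; true; false; not; _∧_; if_then_else_)
import Data.Bool as Bool
open import Data.Bool.Properties using (not-¬; ¬-not; not-involutive)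
open import Data.Fin using (zero; suc; _≟_)
open import Data.Fin.Properties using (¬∀⟶∃¬; suc-injective; any?)
open import Data.Fin.Subset using (∣_∣; _⊆_; _∩_)
open import Data.Fin.Subset.Properties using (_∈?_; x∈p∪q⁺; x∈p∪q⁻; x∈p∩q⁺; x∈p∩q⁻)
open import Data.Maybe using (Maybe; just; nothing)
import Data.Maybe.Properties as Maybe
open import Data.Nat using (zero; suc; _+_; _<_; z≤n; z<s; _≤?_; _<?_)
open import Data.Product using (∃; _,_; proj₁; proj₂; map₂)
import Data.Product as Product
open import Data.Sum using (_⊎_; inj₁; inj₂)
import Data.Sum as Sum
open import Data.Vec using ([]; _∷_; lookup; tabulate)
open import Data.Vec.Functional using (updateAt)
open import Data.Vec.Functional.Properties using (updateAt-updates; updateAt-minimal)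
open import Data.Vec.Properties using (lookup∘tabulate; lookup⇒[]=; []=⇒lookup)
open import Function using (_∘_; const)
open import Relation.Binary.PropositionalEquality
  using (_≡_; _≢_; refl; sym; trans; cong; cong₂; subst; subst₂; module ≡-Reasoning)
open import Relation.Nullary using (Dec; yes; no; does; ¬_; contradiction; _×-dec_; _⊎-dec_; ¬?; map′)
open import Relation.Nullary.Decidable using (dec-true; dec-false; isYes≗does)
open import Relation.Unary using (Decidable)
open import Relation.Unary.Properties using (_∪?_; _∩?_)

≯0⇒≡0 : ∀ {m} → ¬ 0 < m → m ≡ 0
≯0⇒≡0 {zero} _ = refl
≯0⇒≡0 {suc m} ¬0<m = contradiction z<s ¬0<m

≢nothing⇒just : ∀ {a} {A : Set a} {x : Maybe A} → x ≢ nothing → ∃ λ y → x ≡ just y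
≢nothing⇒just {x = just y} _ = y , refl
≢nothing⇒just {x = nothing} x≢nothing = contradiction refl x≢nothing

-- Finite sums over Fin n

infix 10 _when_

_when_ : ∀ {a} {A : Set a} → ℕ → Dec A → ℕ
k when a? = if does a? then k else 0

when-yes : ∀ {a} {A : Set a} {k} (a? : Dec A) → A → k when a? ≡ k
when-yes (yes _) _ = refl
when-yes (no ¬a) a = contradiction a ¬a

when-no : ∀ {a} {A : Set a} {k} (a? : Dec A) → ¬ A → k when a? ≡ 0
when-no (yes a) ¬a = contradiction a ¬a
when-no (no _) _ = refl

when-pos : ∀ {a} {A : Set a} {k} (a? : Dec A) → 0 < k when a? → A
when-pos (yes a) _ = a

∑-mono-≤ : ∀ {n} {f g : Fin n → ℕ} → (∀ i → f i ≤ g i) →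
           ∑[ i < n ] f i ≤ ∑[ i < n ] g i
∑-mono-≤ {zero} f≤g = z≤n
∑-mono-≤ {suc n} f≤g = ℕ.+-mono-≤ (f≤g zero) (∑-mono-≤ (f≤g ∘ suc))

∑-term : ∀ {n} {f : Fin n → ℕ} i → f i ≤ ∑[ j < n ] f j
∑-term zero = ℕ.m≤m+n _ _
∑-term {f = f} (suc i) = ℕ.≤-trans (∑-term i) (ℕ.m≤n+m _ (f zero))

∑-mono-< : ∀ {n} {f g : Fin n → ℕ} → (∀ i → f i ≤ g i) → ∀ i → f i < g i →
           ∑[ i < n ] f i < ∑[ i < n ] g i
∑-mono-< f≤g zero fi<gi = ℕ.+-mono-<-≤ fi<gi (∑-mono-≤ (f≤g ∘ suc))
∑-mono-< f≤g (suc i) fi<gi = ℕ.+-mono-≤-< (f≤g zero) (∑-mono-< (f≤g ∘ suc) i fi<gi)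

∑-<⇒∃< : ∀ {n} {f g : Fin n → ℕ} → ∑[ i < n ] f i < ∑[ i < n ] g i →
         ∃ λ i → f i < g i
∑-<⇒∃< {n} {f} {g} ∑f<∑g =
  map₂ ℕ.≰⇒> (¬∀⟶∃¬ n (λ i → g i ≤ f i) (λ i → g i ≤? f i) (ℕ.<⇒≱ ∑f<∑g ∘ ∑-mono-≤))

∑-≤-≡ : ∀ {n} {f g : Fin n → ℕ} → (∀ i → f i ≤ g i) →
        ∑[ i < n ] f i ≡ ∑[ i < n ] g i → ∀ i → f i ≡ g i
∑-≤-≡ f≤g ∑f≡∑g i with ℕ.m≤n⇒m<n∨m≡n (f≤g i)
... | inj₁ fi<gi = contradiction ∑f≡∑g (ℕ.<⇒≢ (∑-mono-< f≤g i fi<gi))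
... | inj₂ fi≡gi = fi≡gi

∑-δ : ∀ {n} (x : Fin n) (f : Fin n → ℕ) → ∑[ y < n ] (f y when (x ≟ y)) ≡ f x
∑-δ {suc n} zero f = trans (cong (f zero +_) (sum-replicate-zero n)) (ℕ.+-identityʳ (f zero))
∑-δ {suc n} (suc x) f = ∑-δ x (f ∘ suc)

∑-insert : ∀ {n} {f g : Fin n → ℕ} (i : Fin n) {d} →
           (∀ j → j ≢ i → g j ≡ f j) → g i ≡ f i + d →
           ∑[ j < n ] g j ≡ ∑[ j < n ] f j + d
∑-insert {n} {f} {g} i {d} same gi≡fi+d = begin
  ∑[ j < n ] g j                                ≡⟨ sum-cong-≗ pointwise ⟩
  ∑[ j < n ] (f j + d when (i ≟ j))             ≡⟨ ∑-distrib-+ f (λ j → d when (i ≟ j)) ⟩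
  ∑[ j < n ] f j + ∑[ j < n ] (d when (i ≟ j))  ≡⟨ cong (∑[ j < n ] f j +_) (∑-δ i (const d)) ⟩
  ∑[ j < n ] f j + d                            ∎
  where
  open ≡-Reasoning
  pointwise : ∀ j → g j ≡ f j + d when (i ≟ j)
  pointwise j with i ≟ j
  ... | yes refl = gi≡fi+d
  ... | no i≢j = trans (same j (i≢j ∘ sym)) (sym (ℕ.+-identityʳ (f j)))

∑-when : ∀ {a} {A : Set a} {n} {f : Fin n → ℕ} (a? : Dec A) →
         (∑[ i < n ] f i) when a? ≡ ∑[ i < n ] (f i when a?)
∑-when (yes _) = refl
∑-when {n = n} (no _) = sym (sum-replicate-zero n)

∑⟨_⟩ : ∀ {n} {P : Fin n → Set} → Decidable P → (Fin n → ℕ) → ℕ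
∑⟨_⟩ {n} P? f = ∑[ i < n ] (f i when P? i)

#⟨_⟩ : ∀ {n} {P : Fin n → Set} → Decidable P → ℕ
#⟨ P? ⟩ = ∑⟨ P? ⟩ (const 1)

module _ {n : ℕ} {P Q : Fin n → Set} (P? : Decidable P) (Q? : Decidable Q) where

  ∑⟨⟩-cong : ∀ {f g : Fin n → ℕ} → (∀ i → P i → Q i) → (∀ i → Q i → P i) →
             (∀ i → P i → f i ≡ g i) → ∑⟨ P? ⟩ f ≡ ∑⟨ Q? ⟩ g
  ∑⟨⟩-cong {f} {g} P⇒Q Q⇒P f≡g = sum-cong-≗ pointwise
    where
    pointwise : ∀ i → f i when P? i ≡ g i when Q? i
    pointwise i with P? i | Q? i
    ... | yes p | yes _ = f≡g i p
    ... | yes p | no ¬q = contradiction (P⇒Q i p) ¬q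
    ... | no ¬p | yes q = contradiction (Q⇒P i q) ¬p
    ... | no _  | no _  = refl

  ∑⟨⟩-insert : ∀ (f : Fin n → ℕ) {i} → ¬ P i → Q i → (∀ j → j ≢ i → P j → Q j) →
               (∀ j → j ≢ i → Q j → P j) → ∑⟨ Q? ⟩ f ≡ ∑⟨ P? ⟩ f + f i
  ∑⟨⟩-insert f {i} ¬pi qi P⇒Q Q⇒P = ∑-insert i unchanged inserted
    where
    unchanged : ∀ j → j ≢ i → f j when Q? j ≡ f j when P? j
    unchanged j j≢i with P? j | Q? j
    ... | yes _ | yes _ = refl
    ... | yes p | no ¬q = contradiction (P⇒Q j j≢i p) ¬q
    ... | no ¬p | yes q = contradiction (Q⇒P j j≢i q) ¬p
    ... | no _  | no _  = refl
    inserted : f i when Q? i ≡ f i when P? i + f i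
    inserted rewrite when-yes {k = f i} (Q? i) qi | when-no {k = f i} (P? i) ¬pi = refl

module _ {n : ℕ} {P : Fin n → Set} (P? : Decidable P) where

  ∑⟨⟩-zero : ∀ {f : Fin n → ℕ} → (∀ i → P i → f i ≡ 0) → ∑⟨ P? ⟩ f ≡ 0
  ∑⟨⟩-zero {f} f≡0 = trans (sum-cong-≗ pointwise) (sum-replicate-zero n)
    where
    pointwise : ∀ i → f i when P? i ≡ 0
    pointwise i with P? i
    ... | yes p = f≡0 i p
    ... | no _  = refl

  ∑⟨⟩-term : ∀ (f : Fin n → ℕ) {i} → P i → f i ≤ ∑⟨ P? ⟩ f
  ∑⟨⟩-term f {i} p = ℕ.≤-trans (ℕ.≤-reflexive (sym (when-yes (P? i) p))) (∑-term i)

  ∑⟨⟩-witness : ∀ {f : Fin n → ℕ} → 0 < ∑⟨ P? ⟩ f → ∃ λ i → P i × 0 < f i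
  ∑⟨⟩-witness {f} 0<∑
    with ∑-<⇒∃< {f = const 0} {g = λ i → f i when P? i}
                (subst (_< ∑⟨ P? ⟩ f) (sym (sum-replicate-zero n)) 0<∑)
  ... | i , 0<fi with P? i
  ...   | yes p = i , p , 0<fi
  ...   | no _  = contradiction 0<fi (λ ())

module _ {n : ℕ} {P Q : Fin n → Set} (P? : Decidable P) (Q? : Decidable Q) where

  ∑⟨⟩-∪ : ∀ (f : Fin n → ℕ) → (∀ i → P i → ¬ Q i) →
          ∑⟨ P? ∪? Q? ⟩ f ≡ ∑⟨ P? ⟩ f + ∑⟨ Q? ⟩ f
  ∑⟨⟩-∪ f disjoint =
    trans (sum-cong-≗ pointwise) (∑-distrib-+ (λ i → f i when P? i) (λ i → f i when Q? i))
    where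
    pointwise : ∀ i → f i when (P? ∪? Q?) i ≡ f i when P? i + f i when Q? i
    pointwise i with P? i | Q? i
    ... | yes p | yes q = contradiction q (disjoint i p)
    ... | yes _ | no _  = sym (ℕ.+-identityʳ (f i))
    ... | no _  | _     = refl

  ∑⟨⟩-∩ : ∀ (f : Fin n → ℕ) → ∑⟨ P? ∩? Q? ⟩ f ≡ ∑⟨ P? ⟩ (λ i → f i when Q? i)
  ∑⟨⟩-∩ f = sum-cong-≗ pointwise
    where
    pointwise : ∀ i → f i when (P? ∩? Q?) i ≡ (f i when Q? i) when P? i
    pointwise i with P? i | Q? i
    ... | yes _ | yes _ = refl
    ... | yes _ | no _  = refl
    ... | no _  | _     = refl

-- Counting in subsets

∣p∣≡#∈ : ∀ {n} (p : Subset n) → ∣ p ∣ ≡ #⟨ _∈? p ⟩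
∣p∣≡#∈ [] = refl
∣p∣≡#∈ (true ∷ p) = cong suc (∣p∣≡#∈ p)
∣p∣≡#∈ (false ∷ p) = ∣p∣≡#∈ p

⟦_⟧ : ∀ {n} {P : Fin n → Set} → Decidable P → Subset n
⟦ P? ⟧ = tabulate (does ∘ P?)

module _ {n : ℕ} {P : Fin n → Set} (P? : Decidable P) where

  ∈⟦⟧⁺ : ∀ {x} → P x → x ∈ ⟦ P? ⟧
  ∈⟦⟧⁺ {x} px =
    lookup⇒[]= x ⟦ P? ⟧ (trans (lookup∘tabulate (does ∘ P?) x) (dec-true (P? x) px))

  ∈⟦⟧⁻ : ∀ {x} → x ∈ ⟦ P? ⟧ → P x
  ∈⟦⟧⁻ {x} x∈ with P? x | trans (sym (lookup∘tabulate (does ∘ P?) x)) ([]=⇒lookup x∈)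
  ... | yes px | _ = px

module _ {n : ℕ} (φ : Fin n → Fin n) (X : Subset n) where

  ∈-preimage⁺ : ∀ {x i} → x ∈ X → φ x ≡ i → x ∈ preimage φ X i
  ∈-preimage⁺ {x} {i} x∈X φx≡i = lookup⇒[]= x (preimage φ X i) (trans (lookup∘tabulate _ x)
    (cong₂ _∧_ ([]=⇒lookup x∈X) (trans (isYes≗does (φ x ≟ i)) (dec-true (φ x ≟ i) φx≡i))))

  ∈-preimage⁻ : ∀ {x i} → x ∈ preimage φ X i → x ∈ X × φ x ≡ i
  ∈-preimage⁻ {x} {i} x∈
    with lookup X x in x∈X | φ x ≟ i | trans (sym (lookup∘tabulate _ x)) ([]=⇒lookup x∈)
  ... | true | yes φx≡i | _ = lookup⇒[]= x X x∈X , φx≡i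

  ∑⟨⟩-deg : ∀ {G : Fin n → Set} (G? : Decidable G) →
            ∑⟨ G? ⟩ (deg φ X) ≡ #⟨ (λ x → (x ∈? X) ×-dec G? (φ x)) ⟩
  ∑⟨⟩-deg G? = begin
    ∑[ y < n ] (deg φ X y when G? y)
      ≡⟨ sum-cong-≗ (λ y → cong (_when G? y) (∣p∣≡#∈ (preimage φ X y))) ⟩
    ∑[ y < n ] (#⟨ _∈? preimage φ X y ⟩ when G? y)
      ≡⟨ sum-cong-≗ (λ y → ∑-when {f = λ x → 1 when (x ∈? preimage φ X y)} (G? y)) ⟩
    ∑[ y < n ] ∑[ x < n ] ((1 when (x ∈? preimage φ X y)) when G? y)
      ≡⟨ ∑-comm (λ y x → (1 when (x ∈? preimage φ X y)) when G? y) ⟩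
    ∑[ x < n ] ∑[ y < n ] ((1 when (x ∈? preimage φ X y)) when G? y)
      ≡⟨ sum-cong-≗ (λ x → sum-cong-≗ (fibre x)) ⟩
    ∑[ x < n ] ∑[ y < n ] ((1 when ((x ∈? X) ×-dec G? (φ x))) when (φ x ≟ y))
      ≡⟨ sum-cong-≗ (λ x → ∑-δ (φ x) _) ⟩
    #⟨ (λ x → (x ∈? X) ×-dec G? (φ x)) ⟩
      ∎
    where
    open ≡-Reasoning
    fibre : ∀ x y → (1 when (x ∈? preimage φ X y)) when G? y ≡
                    (1 when ((x ∈? X) ×-dec G? (φ x))) when (φ x ≟ y)
    fibre x y with φ x ≟ y
    fibre x y | no φx≢y with x ∈? preimage φ X y | G? y
    ... | yes x∈ | _     = contradiction (proj₂ (∈-preimage⁻ x∈)) φx≢y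
    ... | no _   | yes _ = refl
    ... | no _   | no _  = refl
    fibre x _ | yes refl with x ∈? preimage φ X (φ x) | x ∈? X | G? (φ x)
    ... | yes _  | yes _  | yes _ = refl
    ... | yes _  | yes _  | no _  = refl
    ... | yes x∈ | no x∉  | _     = contradiction (proj₁ (∈-preimage⁻ x∈)) x∉
    ... | no x∉  | yes x∈ | _     = contradiction (∈-preimage⁺ x∈ refl) x∉
    ... | no _   | no _   | yes _ = refl
    ... | no _   | no _   | no _  = refl

x∈p⇒0<∣p∣ : ∀ {n x} (p : Subset n) → x ∈ p → 0 < ∣ p ∣
x∈p⇒0<∣p∣ p x∈p = subst (0 <_) (sym (∣p∣≡#∈ p)) (∑⟨⟩-term (_∈? p) (const 1) x∈p)

deg-∪ : ∀ {n} (φ : Fin n → Fin n) {X Y : Subset n} → (∀ x → x ∈ X → x ∉ Y) →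
        ∀ i → deg φ (X ∪ Y) i ≡ deg φ X i + deg φ Y i
deg-∪ φ {X} {Y} X∩Y≡∅ i = begin
  ∣ preimage φ (X ∪ Y) i ∣
    ≡⟨ ∣p∣≡#∈ (preimage φ (X ∪ Y) i) ⟩
  #⟨ _∈? preimage φ (X ∪ Y) i ⟩
    ≡⟨ ∑⟨⟩-cong (_∈? preimage φ (X ∪ Y) i) ((_∈? φ⁻¹X) ∪? (_∈? φ⁻¹Y)) split merge (λ _ _ → refl) ⟩
  #⟨ (_∈? φ⁻¹X) ∪? (_∈? φ⁻¹Y) ⟩
    ≡⟨ ∑⟨⟩-∪ (_∈? φ⁻¹X) (_∈? φ⁻¹Y) (const 1) disjoint ⟩
  #⟨ _∈? φ⁻¹X ⟩ + #⟨ _∈? φ⁻¹Y ⟩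
    ≡⟨ cong₂ _+_ (∣p∣≡#∈ φ⁻¹X) (∣p∣≡#∈ φ⁻¹Y) ⟨
  ∣ φ⁻¹X ∣ + ∣ φ⁻¹Y ∣
    ∎
  where
  open ≡-Reasoning
  φ⁻¹X φ⁻¹Y : Subset _
  φ⁻¹X = preimage φ X i
  φ⁻¹Y = preimage φ Y i
  split : ∀ x → x ∈ preimage φ (X ∪ Y) i → x ∈ φ⁻¹X ⊎ x ∈ φ⁻¹Y
  split x x∈ with ∈-preimage⁻ φ (X ∪ Y) x∈
  ... | x∈X∪Y , φx≡i = Sum.map (λ x∈X → ∈-preimage⁺ φ X x∈X φx≡i) (λ x∈Y → ∈-preimage⁺ φ Y x∈Y φx≡i)
                               (x∈p∪q⁻ X Y x∈X∪Y)
  merge : ∀ x → x ∈ φ⁻¹X ⊎ x ∈ φ⁻¹Y → x ∈ preimage φ (X ∪ Y) i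
  merge x (inj₁ x∈) = let (x∈X , φx≡i) = ∈-preimage⁻ φ X x∈ in
    ∈-preimage⁺ φ (X ∪ Y) (x∈p∪q⁺ (inj₁ x∈X)) φx≡i
  merge x (inj₂ x∈) = let (x∈Y , φx≡i) = ∈-preimage⁻ φ Y x∈ in
    ∈-preimage⁺ φ (X ∪ Y) (x∈p∪q⁺ (inj₂ x∈Y)) φx≡i
  disjoint : ∀ x → x ∈ φ⁻¹X → x ∉ φ⁻¹Y
  disjoint x x∈ x∈′ = X∩Y≡∅ x (proj₁ (∈-preimage⁻ φ X x∈)) (proj₁ (∈-preimage⁻ φ Y x∈′))

record Enumeration {n : ℕ} (P : Fin n → Set) : Set where
  field
    size : ℕ
    elem : Fin size → Fin n
    elem-P : ∀ k → P (elem k)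
    elem-onto : ∀ {x} → P x → ∃ λ k → elem k ≡ x
    elem-injective : ∀ {k l} → elem k ≡ elem l → k ≡ l

enumerate : ∀ {n} {P : Fin n → Set} → Decidable P → Enumeration P
enumerate {zero} P? = record
  { size = 0 ; elem = λ () ; elem-P = λ () ; elem-onto = λ { {()} } ; elem-injective = λ { {()} } }
enumerate {suc n} {P} P? with enumerate (P? ∘ suc) | P? zero
... | E | no ¬p0 = record
  { size = size
  ; elem = suc ∘ elem
  ; elem-P = elem-P
  ; elem-onto = λ { {zero} p0 → contradiction p0 ¬p0 ; {suc x} px → map₂ (cong suc) (elem-onto px) }
  ; elem-injective = elem-injective ∘ suc-injective
  }
  where open Enumeration E
... | E | yes p0 = record
  { size = suc size
  ; elem = elem′
  ; elem-P = λ { zero → p0 ; (suc k) → elem-P k }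
  ; elem-onto = λ { {zero} _ → zero , refl ; {suc x} px → Product.map suc (cong suc) (elem-onto px) }
  ; elem-injective = injective
  }
  where
  open Enumeration E
  elem′ : Fin (suc size) → Fin (suc n)
  elem′ zero = zero
  elem′ (suc k) = suc (elem k)
  injective : ∀ {k l} → elem′ k ≡ elem′ l → k ≡ l
  injective {zero} {zero} _ = refl
  injective {suc k} {suc l} eq = cong suc (elem-injective (suc-injective eq))

-- colDeg c j is the number of φ-preimages of j of colour c (true is red).  A grouping sends
-- each placed facility to the leader of its group, and an unplaced one to nothing.
module BalancedGrouping {n : ℕ} {S : Fin n → Set} (S? : Decidable S)
  (col : Fin n → Bool) (colDeg : Bool → Fin n → ℕ) where

  ofColour : Bool → Fin n → ℕ
  ofColour c j = 1 when (col j Bool.≟ c)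

  total : Fin n → ℕ
  total j = colDeg true j + colDeg false j

  Bad : Fin n → Set
  Bad j = 0 < colDeg (col j) j

  GoodOf : Bool → Fin n → Set
  GoodOf c j = col j ≡ c × colDeg c j ≡ 0 × 0 < colDeg (not c) j

  -- very good, or good of colour c₀
  Follower : Bool → Fin n → Set
  Follower c₀ j = colDeg (col j) j ≡ 0 × (col j ≡ c₀ ⊎ total j ≡ 0)

  bad? : Decidable Bad
  bad? j = 0 <? colDeg (col j) j

  goodOf? : ∀ c → Decidable (GoodOf c)
  goodOf? c j = (col j Bool.≟ c) ×-dec (colDeg c j ℕ.≟ 0) ×-dec (0 <? colDeg (not c) j)

  total-split : ∀ c j → total j ≡ colDeg c j + colDeg (not c) j
  total-split true j = refl
  total-split false j = ℕ.+-comm (colDeg true j) (colDeg false j)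

  colDeg≤total : ∀ c j → colDeg c j ≤ total j
  colDeg≤total c j = subst (colDeg c j ≤_) (sym (total-split c j)) (ℕ.m≤m+n _ _)

  ofColour≤colDeg : ∀ {i j} → 0 < colDeg (col i) j → ∀ c → ofColour c i ≤ colDeg c j
  ofColour≤colDeg {i} 0<colDeg c with col i Bool.≟ c
  ... | yes refl = 0<colDeg
  ... | no _ = z≤n

  follower-colDeg≡0 : ∀ {c₀ c u} → Follower c₀ u → col u ≡ c ⊎ c ≡ c₀ → colDeg c u ≡ 0
  follower-colDeg≡0 (colDeg≡0 , _) (inj₁ refl) = colDeg≡0
  follower-colDeg≡0 (colDeg≡0 , inj₁ refl) (inj₂ refl) = colDeg≡0
  follower-colDeg≡0 {c = c} {u} (_ , inj₂ total≡0) (inj₂ _) =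
    ℕ.n≤0⇒n≡0 (subst (colDeg c u ≤_) total≡0 (colDeg≤total c u))

  follower-¬goodOf : ∀ {c₀ u} → Follower c₀ u → ¬ GoodOf (not c₀) u
  follower-¬goodOf {c₀} (_ , inj₁ col≡c₀) (col≡¬c₀ , _) = not-¬ col≡c₀ col≡¬c₀
  follower-¬goodOf {c₀} {u} (_ , inj₂ total≡0) (_ , _ , 0<colDeg) =
    ℕ.n≮0 (subst (0 <_) total≡0 (ℕ.≤-trans 0<colDeg (colDeg≤total _ u)))

  Groups : Set
  Groups = Fin n → Maybe (Fin n)

  InGroup : Groups → Fin n → Fin n → Set
  InGroup g a j = g j ≡ just a

  inGroup? : ∀ g a → Decidable (InGroup g a)
  inGroup? g a j = Maybe.≡-dec _≟_ (g j) (just a)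

  Assigned : Groups → Fin n → Set
  Assigned g j = g j ≢ nothing

  assigned? : ∀ g → Decidable (Assigned g)
  assigned? g j = ¬? (Maybe.≡-dec _≟_ (g j) nothing)

  record Pending (g : Groups) (j : Fin n) : Set where
    constructor pending
    field
      in-S : S j
      unassigned : g j ≡ nothing

  pending? : ∀ g → Decidable (Pending g)
  pending? g j = map′ (λ (sj , gj≡nothing) → pending sj gj≡nothing)
                      (λ (pending sj gj≡nothing) → sj , gj≡nothing)
                      (S? j ×-dec Maybe.≡-dec _≟_ (g j) nothing)

  colourCount colDegSum : Groups → Fin n → Bool → ℕ
  colourCount g a c = ∑⟨ inGroup? g a ⟩ (ofColour c)
  colDegSum g a c = ∑⟨ inGroup? g a ⟩ (colDeg c)

  Slack : Groups → Fin n → Set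
  Slack g a = ∀ c → colourCount g a c ≤ colDegSum g a c

  ∑-groups : ∀ g (f : Fin n → ℕ) → ∑[ a < n ] ∑⟨ inGroup? g a ⟩ f ≡ ∑⟨ assigned? g ⟩ f
  ∑-groups g f = trans (∑-comm (λ a j → f j when inGroup? g a j)) (sum-cong-≗ pointwise)
    where
    pointwise : ∀ j → ∑[ a < n ] (f j when inGroup? g a j) ≡ f j when assigned? g j
    pointwise j with g j
    ... | nothing = sum-replicate-zero n
    ... | just b = ∑-δ b (const (f j))

  pending-¬inGroup : ∀ {g i b} → Pending g i → ¬ InGroup g b i
  pending-¬inGroup pi gi≡just = contradiction (trans (sym (Pending.unassigned pi)) gi≡just) λ ()

  assign : Groups → Fin n → Fin n → Groups
  assign g i a = updateAt g i (const (just a))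

  module _ {g : Groups} {i : Fin n} (pi : Pending g i) (a : Fin n) where

    assign-self : InGroup (assign g i a) a i
    assign-self = updateAt-updates i g

    assign-other : ∀ {j} → j ≢ i → assign g i a j ≡ g j
    assign-other j≢i = updateAt-minimal _ i g j≢i

    inGroup-assign⁻ : ∀ {b j} → InGroup (assign g i a) b j →
                      (j ≡ i × b ≡ a) ⊎ (j ≢ i × InGroup g b j)
    inGroup-assign⁻ {b} {j} inGroup′ with j ≟ i
    ... | yes refl = inj₁ (refl , sym (Maybe.just-injective (trans (sym assign-self) inGroup′)))
    ... | no j≢i = inj₂ (j≢i , trans (sym (assign-other j≢i)) inGroup′)

    inGroup-assign⁺ : ∀ {b j} → InGroup g b j → InGroup (assign g i a) b j
    inGroup-assign⁺ {b} {j} inGroup with j ≟ i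
    ... | yes refl = contradiction inGroup (pending-¬inGroup pi)
    ... | no j≢i = trans (assign-other j≢i) inGroup

    ∑-group-self : ∀ f → ∑⟨ inGroup? (assign g i a) a ⟩ f ≡ ∑⟨ inGroup? g a ⟩ f + f i
    ∑-group-self f =
      ∑⟨⟩-insert (inGroup? g a) (inGroup? (assign g i a) a) f (pending-¬inGroup pi) assign-self
                 (λ j j≢i → trans (assign-other j≢i)) (λ j j≢i → trans (sym (assign-other j≢i)))

    ∑-group-other : ∀ {b} f → b ≢ a → ∑⟨ inGroup? (assign g i a) b ⟩ f ≡ ∑⟨ inGroup? g b ⟩ f
    ∑-group-other {b} f b≢a =
      ∑⟨⟩-cong (inGroup? (assign g i a) b) (inGroup? g b) old (λ _ → inGroup-assign⁺) (λ _ _ → refl)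
      where
      old : ∀ j → InGroup (assign g i a) b j → InGroup g b j
      old j inGroup′ with inGroup-assign⁻ inGroup′
      ... | inj₁ (_ , b≡a) = contradiction b≡a b≢a
      ... | inj₂ (_ , inGroup) = inGroup

    ∑-pending-assign : ∀ f → ∑⟨ pending? g ⟩ f ≡ ∑⟨ pending? (assign g i a) ⟩ f + f i
    ∑-pending-assign f = ∑⟨⟩-insert (pending? (assign g i a)) (pending? g) f
      (λ (pending _ gi′≡nothing) → contradiction (trans (sym assign-self) gi′≡nothing) λ ())
      pi
      (λ j j≢i (pending sj gj′≡nothing) → pending sj (trans (sym (assign-other j≢i)) gj′≡nothing))
      (λ j j≢i (pending sj gj≡nothing) → pending sj (trans (assign-other j≢i) gj≡nothing))

  record Structured (c₀ : Bool) (g : Groups) : Set where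
    field
      member-S : ∀ {a j} → InGroup g a j → S j
      leader-self : ∀ {a j} → InGroup g a j → InGroup g a a
      leader-total : ∀ {a} → InGroup g a a → 0 < total a
      follower : ∀ {a j} → InGroup g a j → j ≢ a → Follower c₀ j

  module _ {c₀ : Bool} {g : Groups} (str : Structured c₀ g) {i : Fin n} (pi : Pending g i) where
    open Structured str

    assign-structured : ∀ {a} → InGroup (assign g i a) a a → (a ≡ i → 0 < total i) →
                        (i ≢ a → Follower c₀ i) → Structured c₀ (assign g i a)
    assign-structured {a} leader′ leader-total′ follower′ = record
      { member-S = member-S′
      ; leader-self = leader-self′
      ; leader-total = leader-total″
      ; follower = follower″
      }
      where
      member-S′ : ∀ {b j} → InGroup (assign g i a) b j → S j
      member-S′ inGroup′ with inGroup-assign⁻ pi a inGroup′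
      ... | inj₁ (refl , _) = Pending.in-S pi
      ... | inj₂ (_ , inGroup) = member-S inGroup
      leader-self′ : ∀ {b j} → InGroup (assign g i a) b j → InGroup (assign g i a) b b
      leader-self′ inGroup′ with inGroup-assign⁻ pi a inGroup′
      ... | inj₁ (_ , refl) = leader′
      ... | inj₂ (_ , inGroup) = inGroup-assign⁺ pi a (leader-self inGroup)
      leader-total″ : ∀ {b} → InGroup (assign g i a) b b → 0 < total b
      leader-total″ inGroup′ with inGroup-assign⁻ pi a inGroup′
      ... | inj₁ (refl , refl) = leader-total′ refl
      ... | inj₂ (_ , inGroup) = leader-total inGroup
      follower″ : ∀ {b j} → InGroup (assign g i a) b j → j ≢ b → Follower c₀ j
      follower″ inGroup′ j≢b with inGroup-assign⁻ pi a inGroup′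
      ... | inj₁ (refl , refl) = follower′ j≢b
      ... | inj₂ (_ , inGroup) = follower inGroup j≢b

    open-group : 0 < total i → Structured c₀ (assign g i i)
    open-group 0<total =
      assign-structured (assign-self pi i) (const 0<total) (λ i≢i → contradiction refl i≢i)

    join-group : ∀ {a} → InGroup g a a → Follower c₀ i → Structured c₀ (assign g i a)
    join-group leader fol = assign-structured (inGroup-assign⁺ pi _ leader)
      (λ { refl → contradiction leader (pending-¬inGroup pi) }) (const fol)

    ∑-group-pending≡0 : ∀ f → ∑⟨ inGroup? g i ⟩ f ≡ 0
    ∑-group-pending≡0 f =
      ∑⟨⟩-zero (inGroup? g i) (λ j inGroup → contradiction (leader-self inGroup) (pending-¬inGroup pi))

  slack-assign-other : ∀ {g i a b} → Pending g i → b ≢ a → Slack g b → Slack (assign g i a) b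
  slack-assign-other {a = a} pi b≢a slack c =
    subst₂ _≤_ (sym (∑-group-other pi a (ofColour c) b≢a)) (sym (∑-group-other pi a (colDeg c) b≢a))
               (slack c)

  slack-assign : ∀ {g i a} → Pending g i → (∀ b → b ≢ a → Slack g b) →
                 (∀ c → colourCount g a c + ofColour c i ≤ colDegSum g a c + colDeg c i) →
                 ∀ b → Slack (assign g i a) b
  slack-assign {a = a} pi slack-others extended b with b ≟ a
  ... | yes refl = λ c →
    subst₂ _≤_ (sym (∑-group-self pi a (ofColour c))) (sym (∑-group-self pi a (colDeg c))) (extended c)
  ... | no b≢a = slack-assign-other pi b≢a (slack-others b b≢a)

  pendingGoodOf : Groups → Bool → ℕ
  pendingGoodOf g c = ∑⟨ pending? g ⟩ (λ j → 1 when goodOf? c j)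

  #pending : Groups → ℕ
  #pending g = #⟨ pending? g ⟩

  record Invariant (c₀ : Bool) (g : Groups) : Set where
    field
      structured : Structured c₀ g
      slack : ∀ a → Slack g a
      goods-balanced : pendingGoodOf g (not c₀) ≤ pendingGoodOf g c₀

  Progress : Bool → Groups → Set
  Progress c₀ g = ∃ λ g′ → Invariant c₀ g′ × #pending g′ < #pending g

  #pending-assign-< : ∀ {g i} → Pending g i → ∀ a → #pending (assign g i a) < #pending g
  #pending-assign-< {g} {i} pi a =
    subst (#pending (assign g i a) <_) (sym (∑-pending-assign pi a (const 1))) (ℕ.m<m+n _ z<s)

  pendingGoodOf-assign : ∀ {g i} → Pending g i → ∀ a c →
                         pendingGoodOf g c ≡ pendingGoodOf (assign g i a) c + 1 when goodOf? c i
  pendingGoodOf-assign pi a c = ∑-pending-assign pi a (λ j → 1 when goodOf? c j)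

  goodOf-colour : ∀ {c c′ i} → GoodOf c i → GoodOf c′ i → c ≡ c′
  goodOf-colour (col≡c , _) (col≡c′ , _) = trans (sym col≡c) col≡c′

  goodOf-follower : ∀ {c i} → GoodOf c i → Follower c i
  goodOf-follower (refl , colDeg≡0 , _) = colDeg≡0 , inj₁ refl

  goodOf-pair : ∀ {c i j} → GoodOf (not c) i → GoodOf c j →
                ∀ c′ → ofColour c′ i + ofColour c′ j ≤ colDeg c′ i + colDeg c′ j
  goodOf-pair {c} {i} {j} (colᵢ≡¬c , _ , 0<colDegᵢ) (colⱼ≡c , _ , 0<colDegⱼ) c′ =
    subst (ofColour c′ i + ofColour c′ j ≤_) (ℕ.+-comm (colDeg c′ j) (colDeg c′ i))
      (ℕ.+-mono-≤ (ofColour≤colDeg i-covered c′) (ofColour≤colDeg j-covered c′))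
    where
    i-covered : 0 < colDeg (col i) j
    i-covered = subst (λ c″ → 0 < colDeg c″ j) (sym colᵢ≡¬c) 0<colDegⱼ
    j-covered : 0 < colDeg (col j) i
    j-covered = subst (λ c″ → 0 < colDeg c″ i) (trans (not-involutive c) (sym colⱼ≡c)) 0<colDegᵢ

  goodOf-one-of : ∀ {c i j} → GoodOf (not c) i → GoodOf c j →
                  ∀ c′ → 1 when goodOf? c′ j + 1 when goodOf? c′ i ≡ 1
  goodOf-one-of {c} {i} {j} goodᵢ goodⱼ c′ with c′ Bool.≟ c
  ... | yes refl = cong₂ _+_ (when-yes (goodOf? c′ j) goodⱼ)
                             (when-no (goodOf? c′ i) (not-¬ refl ∘ sym ∘ goodOf-colour goodᵢ))
  ... | no c′≢c = cong₂ _+_ (when-no (goodOf? c′ j) (c′≢c ∘ sym ∘ goodOf-colour goodⱼ))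
                            (when-yes (goodOf? c′ i) (subst (λ c″ → GoodOf c″ i) (sym (¬-not c′≢c)) goodᵢ))

  bad-¬goodOf : ∀ {c i} → Bad i → ¬ GoodOf c i
  bad-¬goodOf bad (refl , colDeg≡0 , _) = ℕ.<⇒≢ bad (sym colDeg≡0)

  module _ {c₀ : Bool} {g : Groups} (inv : Invariant c₀ g) where
    open Invariant inv

    step-bad : ∀ {i} → Pending g i → Bad i → Progress c₀ g
    step-bad {i} pi bad = assign g i i , invariant′ , #pending-assign-< pi i
      where
      unchanged : ∀ c → pendingGoodOf g c ≡ pendingGoodOf (assign g i i) c
      unchanged c = begin
        pendingGoodOf g c
          ≡⟨ pendingGoodOf-assign pi i c ⟩
        pendingGoodOf (assign g i i) c + 1 when goodOf? c i
          ≡⟨ cong (pendingGoodOf (assign g i i) c +_) (when-no (goodOf? c i) (bad-¬goodOf bad)) ⟩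
        pendingGoodOf (assign g i i) c + 0
          ≡⟨ ℕ.+-identityʳ _ ⟩
        pendingGoodOf (assign g i i) c
          ∎
        where open ≡-Reasoning
      singleton : ∀ c → colourCount g i c + ofColour c i ≤ colDegSum g i c + colDeg c i
      singleton c
        rewrite ∑-group-pending≡0 structured pi (ofColour c) | ∑-group-pending≡0 structured pi (colDeg c) =
        ofColour≤colDeg bad c
      invariant′ : Invariant c₀ (assign g i i)
      invariant′ = record
        { structured = open-group structured pi (ℕ.≤-trans bad (colDeg≤total (col i) i))
        ; slack = slack-assign pi (λ b _ → slack b) singleton
        ; goods-balanced = subst₂ _≤_ (unchanged (not c₀)) (unchanged c₀) goods-balanced
        }

    partner : ∀ {i} → Pending g i → GoodOf (not c₀) i → ∃ λ j → Pending g j × GoodOf c₀ j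
    partner {i} pi good = Product.map₂ (Product.map₂ (when-pos (goodOf? c₀ _)))
      (∑⟨⟩-witness (pending? g) (ℕ.<-≤-trans minority-pending goods-balanced))
      where
      minority-pending : 0 < pendingGoodOf g (not c₀)
      minority-pending = ℕ.<-≤-trans (subst (0 <_) (sym (when-yes (goodOf? (not c₀) i) good)) z<s)
                                     (∑⟨⟩-term (pending? g) (λ j → 1 when goodOf? (not c₀) j) pi)

    step-pair : ∀ {i} → Pending g i → GoodOf (not c₀) i → Progress c₀ g
    step-pair {i} pi goodᵢ with partner pi goodᵢ
    ... | j , pj , goodⱼ =
      g₂ , invariant₂ , ℕ.<-trans (#pending-assign-< pj₁ i) (#pending-assign-< pi i)
      where
      open ≡-Reasoning
      j≢i : j ≢ i
      j≢i refl = not-¬ refl (goodOf-colour goodⱼ goodᵢ)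
      g₁ g₂ : Groups
      g₁ = assign g i i
      g₂ = assign g₁ j i
      pj₁ : Pending g₁ j
      pj₁ = pending (Pending.in-S pj) (trans (assign-other pi i j≢i) (Pending.unassigned pj))
      singleton : ∀ f → ∑⟨ inGroup? g₁ i ⟩ f ≡ f i
      singleton f = trans (∑-group-self pi i f) (cong (_+ f i) (∑-group-pending≡0 structured pi f))
      pair : ∀ c → colourCount g₁ i c + ofColour c j ≤ colDegSum g₁ i c + colDeg c j
      pair c rewrite singleton (ofColour c) | singleton (colDeg c) = goodOf-pair goodᵢ goodⱼ c
      removed : ∀ c → pendingGoodOf g c ≡ pendingGoodOf g₂ c + 1
      removed c = begin
        pendingGoodOf g c
          ≡⟨ pendingGoodOf-assign pi i c ⟩
        pendingGoodOf g₁ c + 1 when goodOf? c i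
          ≡⟨ cong (_+ 1 when goodOf? c i) (pendingGoodOf-assign pj₁ i c) ⟩
        pendingGoodOf g₂ c + 1 when goodOf? c j + 1 when goodOf? c i
          ≡⟨ ℕ.+-assoc (pendingGoodOf g₂ c) _ _ ⟩
        pendingGoodOf g₂ c + (1 when goodOf? c j + 1 when goodOf? c i)
          ≡⟨ cong (pendingGoodOf g₂ c +_) (goodOf-one-of goodᵢ goodⱼ c) ⟩
        pendingGoodOf g₂ c + 1
          ∎
      invariant₂ : Invariant c₀ g₂
      invariant₂ = record
        { structured = join-group (open-group structured pi (ℕ.≤-trans (proj₂ (proj₂ goodᵢ)) (colDeg≤total _ i)))
                                  pj₁ (assign-self pi i) (goodOf-follower goodⱼ)
        ; slack = slack-assign pj₁ (λ b b≢i → slack-assign-other pi b≢i (slack b)) pair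
        ; goods-balanced = ℕ.+-cancelʳ-≤ 1 _ _ (subst₂ _≤_ (removed (not c₀)) (removed c₀) goods-balanced)
        }

  ∑-S-split : ∀ {c₀ g} → Structured c₀ g → ∀ f →
              ∑⟨ S? ⟩ f ≡ ∑[ a < n ] ∑⟨ inGroup? g a ⟩ f + ∑⟨ pending? g ⟩ f
  ∑-S-split {g = g} str f = begin
    ∑⟨ S? ⟩ f
      ≡⟨ ∑⟨⟩-cong S? (assigned? g ∪? pending? g) split merge (λ _ _ → refl) ⟩
    ∑⟨ assigned? g ∪? pending? g ⟩ f
      ≡⟨ ∑⟨⟩-∪ (assigned? g) (pending? g) f (λ _ assigned pj → assigned (Pending.unassigned pj)) ⟩
    ∑⟨ assigned? g ⟩ f + ∑⟨ pending? g ⟩ f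
      ≡⟨ cong (_+ ∑⟨ pending? g ⟩ f) (sym (∑-groups g f)) ⟩
    ∑[ a < n ] ∑⟨ inGroup? g a ⟩ f + ∑⟨ pending? g ⟩ f ∎
    where
    open ≡-Reasoning
    split : ∀ j → S j → Assigned g j ⊎ Pending g j
    split j sj with Maybe.≡-dec _≟_ (g j) nothing
    ... | yes unassigned = inj₂ (pending sj unassigned)
    ... | no assigned = inj₁ assigned
    merge : ∀ j → Assigned g j ⊎ Pending g j → S j
    merge j (inj₁ assigned) = Structured.member-S str (proj₂ (≢nothing⇒just assigned))
    merge j (inj₂ pj) = Pending.in-S pj

  nonempty-leader : ∀ {c₀ g a} → Structured c₀ g → ∀ f → 0 < ∑⟨ inGroup? g a ⟩ f → InGroup g a a
  nonempty-leader {g = g} {a} str f 0<∑ =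
    Structured.leader-self str (proj₁ (proj₂ (∑⟨⟩-witness (inGroup? g a) 0<∑)))

  ¬bad-¬minority⇒follower : ∀ {c₀ u} → ¬ Bad u → ¬ GoodOf (not c₀) u → Follower c₀ u
  ¬bad-¬minority⇒follower {c₀} {u} ¬bad ¬minority = own≡0 , colour-or-isolated
    where
    own≡0 : colDeg (col u) u ≡ 0
    own≡0 = ≯0⇒≡0 ¬bad
    colour-or-isolated : col u ≡ c₀ ⊎ total u ≡ 0
    colour-or-isolated with col u Bool.≟ c₀
    ... | yes col≡c₀ = inj₁ col≡c₀
    ... | no col≢c₀ = inj₂ (trans (total-split c₀ u) (cong₂ _+_ majority≡0 minority≡0))
      where
      col≡¬c₀ : col u ≡ not c₀
      col≡¬c₀ = ¬-not col≢c₀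
      minority≡0 : colDeg (not c₀) u ≡ 0
      minority≡0 = subst (λ c → colDeg c u ≡ 0) col≡¬c₀ own≡0
      majority≡0 : colDeg c₀ u ≡ 0
      majority≡0 = ≯0⇒≡0 λ 0<colDeg →
        ¬minority (col≡¬c₀ , minority≡0 , subst (λ c → 0 < colDeg c u) (sym (not-involutive c₀)) 0<colDeg)

  pending-followers : ∀ {c₀ g} → ¬ (∃ λ j → Pending g j × Bad j) →
                      ¬ (∃ λ j → Pending g j × GoodOf (not c₀) j) →
                      ∀ {u} → Pending g u → Follower c₀ u
  pending-followers no-bad no-minority pu =
    ¬bad-¬minority⇒follower (λ bad → no-bad (_ , pu , bad)) (λ minority → no-minority (_ , pu , minority))

  record Grouping (c₀ : Bool) (g : Groups) : Set where
    field
      structured : Structured c₀ g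
      covering : ∀ {j} → S j → ∃ λ a → InGroup g a j
      balanced-groups : ∀ a c → colourCount g a c ≡ colDegSum g a c

  ungrouped : Groups
  ungrouped = const nothing

  initial : ∀ {c₀} → pendingGoodOf ungrouped (not c₀) ≤ pendingGoodOf ungrouped c₀ →
            Invariant c₀ ungrouped
  initial goods = record
    { structured = record { member-S = λ () ; leader-self = λ () ; leader-total = λ () ; follower = λ () }
    ; slack = λ a c →
        subst (_≤ colDegSum ungrouped a c) (sym (∑⟨⟩-zero (inGroup? ungrouped a) {ofColour c} λ _ ())) z≤n
    ; goods-balanced = goods
    }

  module _ (balanced : ∀ c → ∑⟨ S? ⟩ (ofColour c) ≡ ∑⟨ S? ⟩ (colDeg c)) where

    strict-slack : ∀ {c₀ g} → Structured c₀ g → ∀ {c i} → Pending g i → col i ≡ c →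
                   (∀ {u} → Pending g u → colDeg c u ≡ 0) →
                   ∃ λ a → InGroup g a a × colourCount g a c < colDegSum g a c
    strict-slack {g = g} str {c} {i} pi col≡c no-demand =
      map₂ (λ strict → nonempty-leader str (colDeg c) (ℕ.≤-<-trans z≤n strict) , strict) (∑-<⇒∃< total<)
      where
      no-pending-demand : ∑⟨ pending? g ⟩ (colDeg c) ≡ 0
      no-pending-demand = ∑⟨⟩-zero (pending? g) (λ _ → no-demand)
      pending-supply : 0 < ∑⟨ pending? g ⟩ (ofColour c)
      pending-supply = ℕ.<-≤-trans (subst (0 <_) (sym (when-yes (col i Bool.≟ c) col≡c)) z<s)
                                   (∑⟨⟩-term (pending? g) (ofColour c) pi)
      total< : ∑[ a < n ] colourCount g a c < ∑[ a < n ] colDegSum g a c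
      total< = begin-strict
        ∑[ a < n ] colourCount g a c                                 <⟨ ℕ.m<m+n _ pending-supply ⟩
        ∑[ a < n ] colourCount g a c + ∑⟨ pending? g ⟩ (ofColour c)  ≡⟨ ∑-S-split str (ofColour c) ⟨
        ∑⟨ S? ⟩ (ofColour c)                                         ≡⟨ balanced c ⟩
        ∑⟨ S? ⟩ (colDeg c)                                           ≡⟨ ∑-S-split str (colDeg c) ⟩
        ∑[ a < n ] colDegSum g a c + ∑⟨ pending? g ⟩ (colDeg c)      ≡⟨ cong (∑[ a < n ] colDegSum g a c +_) no-pending-demand ⟩
        ∑[ a < n ] colDegSum g a c + 0                               ≡⟨ ℕ.+-identityʳ _ ⟩
        ∑[ a < n ] colDegSum g a c                                   ∎
        where open ℕ.≤-Reasoning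

    step-join : ∀ {c₀ g} → Invariant c₀ g → ∀ {i} → Pending g i →
                (∀ {u} → Pending g u → Follower c₀ u) →
                (∀ {u} → Pending g u → col u ≡ col i ⊎ col i ≡ c₀) → Progress c₀ g
    step-join {c₀} {g} inv {i} pi followers same-colour
      with strict-slack (Invariant.structured inv) pi refl
                        (λ pu → follower-colDeg≡0 (followers pu) (same-colour pu))
    ... | a , leader , strict = assign g i a , invariant′ , #pending-assign-< pi a
      where
      open Invariant inv
      join : ∀ c → colourCount g a c + ofColour c i ≤ colDegSum g a c + colDeg c i
      join c with col i Bool.≟ c
      ... | yes refl = ℕ.≤-trans (subst (_≤ colDegSum g a c) (ℕ.+-comm 1 _) strict) (ℕ.m≤m+n _ _)
      ... | no _ = ℕ.+-mono-≤ (slack a c) z≤n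
      minority-gone : pendingGoodOf (assign g i a) (not c₀) ≡ 0
      minority-gone = ℕ.m+n≡0⇒m≡0 _ (trans (sym (pendingGoodOf-assign pi a (not c₀)))
        (∑⟨⟩-zero (pending? g) λ u pu → when-no (goodOf? (not c₀) u) (follower-¬goodOf (followers pu))))
      invariant′ : Invariant c₀ (assign g i a)
      invariant′ = record
        { structured = join-group structured pi leader (followers pi)
        ; slack = slack-assign pi (λ b _ → slack b) join
        ; goods-balanced = subst (_≤ pendingGoodOf (assign g i a) c₀) (sym minority-gone) z≤n
        }

    step : ∀ {c₀ g} → Invariant c₀ g → (∀ {j} → ¬ Pending g j) ⊎ Progress c₀ g
    step {c₀} {g} inv with any? (pending? g ∩? bad?)
    ... | yes (i , pi , bad) = inj₂ (step-bad inv pi bad)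
    ... | no no-bad with any? (pending? g ∩? goodOf? (not c₀))
    ... | yes (i , pi , minority) = inj₂ (step-pair inv pi minority)
    -- pending facilities of colour c₀ go first, so the remaining ones all share a colour
    ... | no no-minority with any? (pending? g ∩? λ j → col j Bool.≟ c₀)
    ... | yes (i , pi , col≡c₀) =
      inj₂ (step-join inv pi (pending-followers no-bad no-minority) (λ _ → inj₂ col≡c₀))
    ... | no no-majority with any? (pending? g)
    ... | yes (i , pi) = inj₂ (step-join inv pi (pending-followers no-bad no-minority)
                                 λ pu → inj₁ (trans (¬-not (off pu)) (sym (¬-not (off pi)))))
      where
      off : ∀ {u} → Pending g u → col u ≢ c₀
      off pu col≡c₀ = no-majority (_ , pu , col≡c₀)
    ... | no none = inj₁ λ pj → none (_ , pj)

    run : ∀ {c₀} k g → #pending g ≤ k → Invariant c₀ g →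
          ∃ λ g′ → Invariant c₀ g′ × (∀ {j} → ¬ Pending g′ j)
    run k g #pending≤k inv with step inv
    ... | inj₁ done = g , inv , done
    run (suc k) g #pending≤k inv | inj₂ (g′ , inv′ , fewer) =
      run k g′ (ℕ.≤-pred (ℕ.≤-trans fewer #pending≤k)) inv′
    run zero g #pending≤0 inv | inj₂ (g′ , inv′ , fewer) =
      contradiction (ℕ.≤-trans fewer #pending≤0) ℕ.n≮0

    complete-grouping : ∀ {c₀ g} → Invariant c₀ g → (∀ {j} → ¬ Pending g j) → Grouping c₀ g
    complete-grouping {g = g} inv done = record
      { structured = structured
      ; covering = covering
      ; balanced-groups = λ a c → ∑-≤-≡ (λ a → slack a c) (totals c) a
      }
      where
      open Invariant inv
      covering : ∀ {j} → S j → ∃ λ a → InGroup g a j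
      covering {j} sj with Maybe.≡-dec _≟_ (g j) nothing
      ... | yes unassigned = contradiction (pending sj unassigned) done
      ... | no assigned = ≢nothing⇒just assigned
      ∑-S-grouped : ∀ f → ∑⟨ S? ⟩ f ≡ ∑[ a < n ] ∑⟨ inGroup? g a ⟩ f
      ∑-S-grouped f = trans (∑-S-split structured f)
        (trans (cong (∑[ a < n ] ∑⟨ inGroup? g a ⟩ f +_) (∑⟨⟩-zero (pending? g) λ _ pj → contradiction pj done))
               (ℕ.+-identityʳ _))
      totals : ∀ c → ∑[ a < n ] colourCount g a c ≡ ∑[ a < n ] colDegSum g a c
      totals c = trans (sym (∑-S-grouped (ofColour c))) (trans (balanced c) (∑-S-grouped (colDeg c)))

    run-to-completion : ∀ {c₀ g} → Invariant c₀ g → ∃ λ g′ → Grouping c₀ g′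
    run-to-completion {g = g} inv with run (#pending g) g ℕ.≤-refl inv
    ... | g′ , inv′ , done = g′ , complete-grouping inv′ done

    grouping : ∃ λ c₀ → ∃ λ g → Grouping c₀ g
    grouping with ℕ.≤-total (pendingGoodOf ungrouped false) (pendingGoodOf ungrouped true)
    ... | inj₁ goods = true , run-to-completion (initial goods)
    ... | inj₂ goods = false , run-to-completion (initial goods)

module BlockDecomposition {n : ℕ} (𝓡 𝓑 R B R* B* : Subset n) (φ : Fin n → Fin n)
  (𝓡∩𝓑≡∅ : ∀ x → x ∈ 𝓡 → x ∉ 𝓑)
  (R⊆𝓡 : R ⊆ 𝓡) (B⊆𝓑 : B ⊆ 𝓑) (R*⊆𝓡 : R* ⊆ 𝓡) (B*⊆𝓑 : B* ⊆ 𝓑)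
  (∣R∣≡∣R*∣ : ∣ R ∣ ≡ ∣ R* ∣) (∣B∣≡∣B*∣ : ∣ B ∣ ≡ ∣ B* ∣)
  (S∩O≡∅ : ∀ x → x ∈ R ∪ B → x ∉ R* ∪ B*)
  (φ[O]⊆S : ∀ o → o ∈ R* ∪ B* → φ o ∈ R ∪ B) where

  S O : Subset n
  S = R ∪ B
  O = R* ∪ B*

  palette sol opt : Bool → Subset n
  palette c = if c then 𝓡 else 𝓑
  sol c = if c then R else B
  opt c = if c then R* else B*

  col : Fin n → Bool
  col x = does (x ∈? 𝓡)

  palette-col : ∀ {c x} → x ∈ palette c → col x ≡ c
  palette-col {true} {x} x∈𝓡 = dec-true (x ∈? 𝓡) x∈𝓡
  palette-col {false} {x} x∈𝓑 = dec-false (x ∈? 𝓡) (λ x∈𝓡 → 𝓡∩𝓑≡∅ x x∈𝓡 x∈𝓑)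

  sol⊆palette : ∀ c → sol c ⊆ palette c
  sol⊆palette true = R⊆𝓡
  sol⊆palette false = B⊆𝓑

  opt⊆palette : ∀ c → opt c ⊆ palette c
  opt⊆palette true = R*⊆𝓡
  opt⊆palette false = B*⊆𝓑

  sol⊆S : ∀ c → sol c ⊆ S
  sol⊆S true = x∈p∪q⁺ ∘ inj₁
  sol⊆S false = x∈p∪q⁺ ∘ inj₂

  opt⊆O : ∀ c → opt c ⊆ O
  opt⊆O true = x∈p∪q⁺ ∘ inj₁
  opt⊆O false = x∈p∪q⁺ ∘ inj₂

  ∈sol-col : ∀ {x} → x ∈ S → x ∈ sol (col x)
  ∈sol-col {x} x∈S with x∈p∪q⁻ R B x∈S
  ... | inj₁ x∈R = subst (λ c → x ∈ sol c) (sym (palette-col {true} (R⊆𝓡 x∈R))) x∈R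
  ... | inj₂ x∈B = subst (λ c → x ∈ sol c) (sym (palette-col {false} (B⊆𝓑 x∈B))) x∈B

  ∈opt-col : ∀ {x} → x ∈ O → x ∈ opt (col x)
  ∈opt-col {x} x∈O with x∈p∪q⁻ R* B* x∈O
  ... | inj₁ x∈R* = subst (λ c → x ∈ opt c) (sym (palette-col {true} (R*⊆𝓡 x∈R*))) x∈R*
  ... | inj₂ x∈B* = subst (λ c → x ∈ opt c) (sym (palette-col {false} (B*⊆𝓑 x∈B*))) x∈B*

  ∣sol∣≡∣opt∣ : ∀ c → ∣ sol c ∣ ≡ ∣ opt c ∣
  ∣sol∣≡∣opt∣ true = ∣R∣≡∣R*∣
  ∣sol∣≡∣opt∣ false = ∣B∣≡∣B*∣

  colDeg : Bool → Fin n → ℕ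
  colDeg c = deg φ (opt c)

  open BalancedGrouping (_∈? S) col colDeg

  balanced : ∀ c → ∑⟨ _∈? S ⟩ (ofColour c) ≡ ∑⟨ _∈? S ⟩ (colDeg c)
  balanced c = begin
    ∑⟨ _∈? S ⟩ (ofColour c)
      ≡⟨ ∑⟨⟩-∩ (_∈? S) (λ x → col x Bool.≟ c) (const 1) ⟨
    #⟨ (λ x → x ∈? S ×-dec col x Bool.≟ c) ⟩
      ≡⟨ ∑⟨⟩-cong (λ x → x ∈? S ×-dec col x Bool.≟ c) (_∈? sol c) ⇒sol sol⇒ (λ _ _ → refl) ⟩
    #⟨ _∈? sol c ⟩
      ≡⟨ ∣p∣≡#∈ (sol c) ⟨
    ∣ sol c ∣
      ≡⟨ ∣sol∣≡∣opt∣ c ⟩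
    ∣ opt c ∣
      ≡⟨ ∣p∣≡#∈ (opt c) ⟩
    #⟨ _∈? opt c ⟩
      ≡⟨ ∑⟨⟩-cong (_∈? opt c) (λ x → x ∈? opt c ×-dec φ x ∈? S) ⇒φ∈S (λ _ → proj₁) (λ _ _ → refl) ⟩
    #⟨ (λ x → x ∈? opt c ×-dec φ x ∈? S) ⟩
      ≡⟨ ∑⟨⟩-deg φ (opt c) (_∈? S) ⟨
    ∑⟨ _∈? S ⟩ (colDeg c)
      ∎
    where
    open ≡-Reasoning
    ⇒sol : ∀ x → x ∈ S × col x ≡ c → x ∈ sol c
    ⇒sol x (x∈S , refl) = ∈sol-col x∈S
    sol⇒ : ∀ x → x ∈ sol c → x ∈ S × col x ≡ c
    sol⇒ x x∈sol = sol⊆S c x∈sol , palette-col (sol⊆palette c x∈sol)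
    ⇒φ∈S : ∀ x → x ∈ opt c → x ∈ opt c × φ x ∈ S
    ⇒φ∈S x x∈opt = x∈opt , φ[O]⊆S x (opt⊆O c x∈opt)

  deg-O : ∀ i → deg φ O i ≡ total i
  deg-O = deg-∪ φ (λ x x∈R* x∈B* → 𝓡∩𝓑≡∅ x (R*⊆𝓡 x∈R*) (B*⊆𝓑 x∈B*))

  palette-SameColour : ∀ {c x y} → x ∈ palette c → y ∈ palette c → SameColour 𝓡 𝓑 x y
  palette-SameColour {true} x∈𝓡 y∈𝓡 = inj₁ (x∈𝓡 , y∈𝓡)
  palette-SameColour {false} x∈𝓑 y∈𝓑 = inj₂ (x∈𝓑 , y∈𝓑)

  SameColour⇒col≡ : ∀ {x y} → SameColour 𝓡 𝓑 x y → col x ≡ col y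
  SameColour⇒col≡ (inj₁ (x∈𝓡 , y∈𝓡)) = trans (palette-col {true} x∈𝓡) (sym (palette-col {true} y∈𝓡))
  SameColour⇒col≡ (inj₂ (x∈𝓑 , y∈𝓑)) = trans (palette-col {false} x∈𝓑) (sym (palette-col {false} y∈𝓑))

  col≡⇒SameColour : ∀ {x y} → x ∈ S → y ∈ S → col x ≡ col y → SameColour 𝓡 𝓑 x y
  col≡⇒SameColour {x} {y} x∈S y∈S colx≡coly =
    palette-SameColour (sol⊆palette (col x) (∈sol-col x∈S))
                       (subst (λ c → y ∈ palette c) (sym colx≡coly) (sol⊆palette (col y) (∈sol-col y∈S)))

  follower-Good⊎VeryGood : ∀ {c₀ i} → Follower c₀ i → Good 𝓡 𝓑 φ O i ⊎ VeryGood φ O i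
  follower-Good⊎VeryGood {i = i} (own≡0 , _) with total i ℕ.≟ 0
  ... | yes total≡0 = inj₂ (trans (deg-O i) total≡0)
  ... | no total≢0 = inj₁ (subst (0 <_) (sym (deg-O i)) (ℕ.n≢0⇒n>0 total≢0) , no-own-colour)
    where
    no-own-colour : ∀ o → o ∈ preimage φ O i → ¬ SameColour 𝓡 𝓑 i o
    no-own-colour o o∈ same with ∈-preimage⁻ φ O o∈
    ... | o∈O , φo≡i = ℕ.<⇒≢ (x∈p⇒0<∣p∣ (preimage φ (opt (col i)) i) o∈own) (sym own≡0)
      where
      o∈own : o ∈ preimage φ (opt (col i)) i
      o∈own = ∈-preimage⁺ φ (opt (col i))
        (subst (λ c → o ∈ opt c) (sym (SameColour⇒col≡ same)) (∈opt-col o∈O)) φo≡i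

  follower-Good⇒col : ∀ {c₀ i} → Follower c₀ i → Good 𝓡 𝓑 φ O i → col i ≡ c₀
  follower-Good⇒col (_ , inj₁ col≡c₀) _ = col≡c₀
  follower-Good⇒col {i = i} (_ , inj₂ total≡0) (0<deg , _) =
    contradiction (trans (deg-O i) total≡0) (ℕ.<⇒≢ 0<deg ∘ sym)

  module Blocks {c₀ : Bool} {g : Groups} (grouped : Grouping c₀ g) where
    open Grouping grouped
    open Structured structured

    InBlock : Fin n → Fin n → Set
    InBlock a x = InGroup g a x ⊎ (x ∈ O × InGroup g a (φ x))

    inBlock? : ∀ a → Decidable (InBlock a)
    inBlock? a x = inGroup? g a x ⊎-dec (x ∈? O ×-dec inGroup? g a (φ x))

    block : Fin n → Subset n
    block a = ⟦ inBlock? a ⟧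

    S-inBlock : ∀ {a x} → x ∈ S → InBlock a x → InGroup g a x
    S-inBlock x∈S (inj₁ inGroup) = inGroup
    S-inBlock x∈S (inj₂ (x∈O , _)) = contradiction x∈O (S∩O≡∅ _ x∈S)

    O-inBlock : ∀ {a x} → x ∈ O → InBlock a x → InGroup g a (φ x)
    O-inBlock x∈O (inj₁ inGroup) = contradiction x∈O (S∩O≡∅ _ (member-S inGroup))
    O-inBlock x∈O (inj₂ (_ , inGroup)) = inGroup

    inBlock-unique : ∀ {a b x} → InBlock a x → InBlock b x → a ≡ b
    inBlock-unique (inj₁ inGroupᵃ) inBlockᵇ =
      Maybe.just-injective (trans (sym inGroupᵃ) (S-inBlock (member-S inGroupᵃ) inBlockᵇ))
    inBlock-unique (inj₂ (x∈O , inGroupᵃ)) inBlockᵇ =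
      Maybe.just-injective (trans (sym inGroupᵃ) (O-inBlock x∈O inBlockᵇ))

    inBlock-leader : ∀ {x} → x ∈ S ∪ O → ∃ λ a → InGroup g a a × InBlock a x
    inBlock-leader {x} x∈S∪O with x∈p∪q⁻ S O x∈S∪O
    ... | inj₁ x∈S = let (a , inGroup) = covering x∈S in
      a , leader-self inGroup , inj₁ inGroup
    ... | inj₂ x∈O = let (a , inGroup) = covering (φ[O]⊆S x x∈O) in
      a , leader-self inGroup , inj₂ (x∈O , inGroup)

    partition : (E : Enumeration (λ a → InGroup g a a)) →
                IsPartition (S ∪ O) (block ∘ Enumeration.elem E)
    partition E = within , covered , disjoint , inhabited
      where
      open Enumeration E
      within : ∀ k → block (elem k) ⊆ S ∪ O
      within k x∈ with ∈⟦⟧⁻ (inBlock? (elem k)) x∈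
      ... | inj₁ inGroup = x∈p∪q⁺ (inj₁ (member-S inGroup))
      ... | inj₂ (x∈O , _) = x∈p∪q⁺ (inj₂ x∈O)
      covered : ∀ x → x ∈ S ∪ O → ∃ λ k → x ∈ block (elem k)
      covered x x∈S∪O with inBlock-leader x∈S∪O
      ... | a , leader , inBlock with elem-onto leader
      ... | k , refl = k , ∈⟦⟧⁺ (inBlock? (elem k)) inBlock
      disjoint : ∀ k l x → x ∈ block (elem k) → x ∈ block (elem l) → k ≡ l
      disjoint k l x x∈k x∈l =
        elem-injective (inBlock-unique (∈⟦⟧⁻ (inBlock? (elem k)) x∈k) (∈⟦⟧⁻ (inBlock? (elem l)) x∈l))
      inhabited : ∀ k → ∃ λ x → x ∈ block (elem k)
      inhabited k = elem k , ∈⟦⟧⁺ (inBlock? (elem k)) (inj₁ (elem-P k))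

    module _ {a : Fin n} (leader : InGroup g a a) where

      member : ∀ {i} → i ∈ block a ∩ S → InGroup g a i
      member i∈ = let (i∈T , i∈S) = x∈p∩q⁻ (block a) S i∈ in S-inBlock i∈S (∈⟦⟧⁻ (inBlock? a) i∈T)

      block-balanced : ∀ c → ∣ block a ∩ sol c ∣ ≡ ∣ block a ∩ opt c ∣
      block-balanced c = begin
        ∣ block a ∩ sol c ∣
          ≡⟨ ∣p∣≡#∈ (block a ∩ sol c) ⟩
        #⟨ _∈? block a ∩ sol c ⟩
          ≡⟨ ∑⟨⟩-cong (_∈? block a ∩ sol c) (λ x → inGroup? g a x ×-dec col x Bool.≟ c) sol⇒ ⇒sol (λ _ _ → refl) ⟩
        #⟨ (λ x → inGroup? g a x ×-dec col x Bool.≟ c) ⟩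
          ≡⟨ ∑⟨⟩-∩ (inGroup? g a) (λ x → col x Bool.≟ c) (const 1) ⟩
        colourCount g a c
          ≡⟨ balanced-groups a c ⟩
        colDegSum g a c
          ≡⟨ ∑⟨⟩-deg φ (opt c) (inGroup? g a) ⟩
        #⟨ (λ x → x ∈? opt c ×-dec inGroup? g a (φ x)) ⟩
          ≡⟨ ∑⟨⟩-cong (λ x → x ∈? opt c ×-dec inGroup? g a (φ x)) (_∈? block a ∩ opt c) ⇒opt opt⇒ (λ _ _ → refl) ⟩
        #⟨ _∈? block a ∩ opt c ⟩
          ≡⟨ ∣p∣≡#∈ (block a ∩ opt c) ⟨
        ∣ block a ∩ opt c ∣
          ∎
        where
        open ≡-Reasoning
        sol⇒ : ∀ x → x ∈ block a ∩ sol c → InGroup g a x × col x ≡ c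
        sol⇒ x x∈ = let (x∈T , x∈sol) = x∈p∩q⁻ (block a) (sol c) x∈ in
          S-inBlock (sol⊆S c x∈sol) (∈⟦⟧⁻ (inBlock? a) x∈T) , palette-col (sol⊆palette c x∈sol)
        ⇒sol : ∀ x → InGroup g a x × col x ≡ c → x ∈ block a ∩ sol c
        ⇒sol x (inGroup , refl) = x∈p∩q⁺ (∈⟦⟧⁺ (inBlock? a) (inj₁ inGroup) , ∈sol-col (member-S inGroup))
        ⇒opt : ∀ x → x ∈ opt c × InGroup g a (φ x) → x ∈ block a ∩ opt c
        ⇒opt x (x∈opt , inGroup) = x∈p∩q⁺ (∈⟦⟧⁺ (inBlock? a) (inj₂ (opt⊆O c x∈opt , inGroup)) , x∈opt)
        opt⇒ : ∀ x → x ∈ block a ∩ opt c → x ∈ opt c × InGroup g a (φ x)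
        opt⇒ x x∈ = let (x∈T , x∈opt) = x∈p∩q⁻ (block a) (opt c) x∈ in
          x∈opt , O-inBlock (opt⊆O c x∈opt) (∈⟦⟧⁻ (inBlock? a) x∈T)

      block-conditions : BlockConditions 𝓡 𝓑 R B R* B* φ (block a)
      block-conditions =
        (block-balanced true , block-balanced false) ,
        (preimage-inside , image-inside) ,
        (a , x∈p∩q⁺ (∈⟦⟧⁺ (inBlock? a) (inj₁ leader) , member-S leader) ,
             subst (0 <_) (sym (deg-O a)) (leader-total leader) ,
             (λ i i∈ i≢a → follower-Good⊎VeryGood (follower (member i∈) i≢a)) ,
             goods-same-colour)
        where
        preimage-inside : ∀ i → i ∈ S ∩ block a → preimage φ O i ⊆ block a
        preimage-inside i i∈ o∈ =
          let (i∈S , i∈T) = x∈p∩q⁻ S (block a) i∈ ; (o∈O , φo≡i) = ∈-preimage⁻ φ O o∈ in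
          ∈⟦⟧⁺ (inBlock? a) (inj₂ (o∈O , trans (cong g φo≡i) (S-inBlock i∈S (∈⟦⟧⁻ (inBlock? a) i∈T))))
        image-inside : ∀ o → o ∈ O ∩ block a → φ o ∈ block a
        image-inside o o∈ = let (o∈O , o∈T) = x∈p∩q⁻ O (block a) o∈ in
          ∈⟦⟧⁺ (inBlock? a) (inj₁ (O-inBlock o∈O (∈⟦⟧⁻ (inBlock? a) o∈T)))
        goods-same-colour : ∀ i j → i ∈ block a ∩ S → j ∈ block a ∩ S → i ≢ a → j ≢ a →
                            Good 𝓡 𝓑 φ O i → Good 𝓡 𝓑 φ O j → SameColour 𝓡 𝓑 i j
        goods-same-colour i j i∈ j∈ i≢a j≢a goodᵢ goodⱼ =
          col≡⇒SameColour (member-S (member i∈)) (member-S (member j∈))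
            (trans (follower-Good⇒col (follower (member i∈) i≢a) goodᵢ)
                   (sym (follower-Good⇒col (follower (member j∈) j≢a) goodⱼ)))

  blocks : Σ ℕ λ m → Σ (Fin m → Subset n) λ ℬ →
           IsPartition (S ∪ O) ℬ × (∀ k → BlockConditions 𝓡 𝓑 R B R* B* φ (ℬ k))
  blocks with grouping balanced
  ... | c₀ , g , grouped = size , block ∘ elem , partition leaders , block-conditions ∘ elem-P
    where
    open Blocks grouped
    leaders = enumerate (λ a → inGroup? g a a)
    open Enumeration leaders

-- Only the feasibility of both solutions and φ(O) ⊆ S are used: the decomposition is
-- purely combinatorial.
lemma1 : {n : ℕ} (d : Fin n → Fin n → ℚ) → IsMetric d →
    (C 𝓡 𝓑 : Subset n) → (∀ x → x ∈ 𝓡 → x ∉ 𝓑) →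
    (kr kb p : ℕ) → 1 ≤ p →
    (R B R* B* : Subset n) →
    LocallyOptimal d C 𝓡 𝓑 kr kb p R B →
    Optimal d C 𝓡 𝓑 kr kb R* B* →
    (∀ x → x ∈ R ∪ B → x ∉ R* ∪ B*) →
    (φ : Fin n → Fin n) → IsNearestMap d (R ∪ B) (R* ∪ B*) φ →
    Σ ℕ λ m → Σ (Fin m → Subset n) λ ℬ →
      IsPartition ((R ∪ B) ∪ (R* ∪ B*)) ℬ ×
      (∀ a → BlockConditions 𝓡 𝓑 R B R* B* φ (ℬ a))
lemma1 d _ C 𝓡 𝓑 𝓡∩𝓑≡∅ kr kb p _ R B R* B*
       ((R⊆𝓡 , B⊆𝓑 , ∣R∣≡kr , ∣B∣≡kb) , _) ((R*⊆𝓡 , B*⊆𝓑 , ∣R*∣≡kr , ∣B*∣≡kb) , _) S∩O≡∅ φ nearest =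
  BlockDecomposition.blocks 𝓡 𝓑 R B R* B* φ 𝓡∩𝓑≡∅ R⊆𝓡 B⊆𝓑 R*⊆𝓡 B*⊆𝓑
    (trans ∣R∣≡kr (sym ∣R*∣≡kr)) (trans ∣B∣≡kb (sym ∣B*∣≡kb)) S∩O≡∅ (λ o o∈O → proj₁ (nearest o o∈O))
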